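{- For every graph $G$ in the family $\mathfrak{T}$, the multigraph $^2G$ satisfies ${\rm lir}(^2G)\le 3$.
   Context: The family $\mathfrak{T}$ of graphs is defined recursively: the triangle $K_3$ belongs to $\mathfrak{T}$; and if $G\in\mathfrak{T}$, then $\mathfrak{T}$ also contains any graph $G'$ obtained from $G$ by identifying a vertex $v\in V(G)$ of degree 2 that belongs to a triangle of $G$ either with an end vertex of a (new) path of even length, or with an end vertex of a (new) path of odd length whose other end vertex is identified with a vertex of a new triangle. For a graph $G$, $^2G$ denotes the multigraph obtained from $G$ by replacing every edge by two parallel edges. The degree of a vertex in a multigraph counts parallel edges with multiplicity. A multigraph is locally irregular if any two adjacent vertices have distinct degrees. A locally irregular edge coloring of a multigraph $M$ is an assignment of colors to the individual edges of $M$ (the two parallel copies of an edge may receive different colors) such that, for each color, the submultigraph formed by the edges of that color is locally irregular. ${\rm lir}(M)$ is the smallest number of colors in a locally irregular edge coloring of $M$. -}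

module Defs where

open import Data.Nat using (ℕ; zero; suc; _+_; _*_; _≤_)
open import Data.Fin using (Fin; zero; suc; _↑ˡ_; _↑ʳ_; fromℕ; _≟_)
open import Data.List using (List; []; _∷_; _++_; map; length; allFin; lookup)
open import Data.Nat.ListAction using (sum)
open import Data.Product using (_×_; _,_; proj₁; proj₂; Σ; ∃; ∃-syntax)
open import Data.Sum using (_⊎_)
open import Data.Bool using (if_then_else_; _∨_)
open import Relation.Nullary using (¬_; does)
open import Relation.Binary.PropositionalEquality using (_≡_; _≢_)
open import Data.List.Membership.Propositional using (_∈_)

-- A (finite, simple) graph: vertex set Fin n, edges as a list of vertex pairs.
-- All graphs built below (the family 𝔗) have no loops and no repeated edges.
record Graph : Set where
  constructor mkGraph
  field
    n     : ℕ
    edges : List (Fin n × Fin n)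
open Graph public

Adj : (G : Graph) → Fin (n G) → Fin (n G) → Set
Adj G u v = ((u , v) ∈ edges G) ⊎ ((v , u) ∈ edges G)

incident : ∀ {m} → Fin m → Fin m × Fin m → ℕ
incident v (a , b) = if does (a ≟ v) ∨ does (b ≟ v) then 1 else 0

deg : (G : Graph) → Fin (n G) → ℕ
deg G v = sum (map (incident v) (edges G))

InTriangle : (G : Graph) → Fin (n G) → Set
InTriangle G v = ∃[ u ] ∃[ w ] (u ≢ w × Adj G v u × Adj G v w × Adj G u w)

K3 : Graph
K3 = mkGraph 3 ((zero , suc zero) ∷ (suc zero , suc (suc zero)) ∷ (zero , suc (suc zero)) ∷ [])

pathList : (m : ℕ) → List (Fin m × Fin m)
pathList zero = []
pathList (suc zero) = []
pathList (suc (suc m)) =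
  (zero , suc zero) ∷ map (λ { (a , b) → (suc a , suc b) }) (pathList (suc m))

-- attach a new path of length (suc L) at vertex v: the new vertices are
-- n, n+1, ..., n+L, with edges v - n - (n+1) - ... - (n+L)
attachPath : (G : Graph) → Fin (n G) → (L : ℕ) → Graph
attachPath (mkGraph k E) v L =
  mkGraph (k + suc L)
    ( map (λ { (a , b) → ((a ↑ˡ (suc L)) , (b ↑ˡ (suc L))) }) E
   ++ (((v ↑ˡ (suc L)) , (k ↑ʳ zero))
       ∷ map (λ { (a , b) → ((k ↑ʳ a) , (k ↑ʳ b)) }) (pathList (suc L))))

pathEnd : (G : Graph) → (L : ℕ) → Fin (n G + suc L)
pathEnd G L = ((n G) ↑ʳ (fromℕ L))

-- identify vertex w with a vertex of a new triangle (two new vertices a, b)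
attachTriangle : (G : Graph) → Fin (n G) → Graph
attachTriangle (mkGraph k E) w =
  mkGraph (k + 2)
    ( map (λ { (a , b) → ((a ↑ˡ 2) , (b ↑ˡ 2)) }) E
   ++ (((w ↑ˡ 2) , (k ↑ʳ zero))
       ∷ ((w ↑ˡ 2) , (k ↑ʳ (suc zero)))
       ∷ ((k ↑ʳ zero) , (k ↑ʳ (suc zero))) ∷ []))

data InT : Graph → Set where
  tri     : InT K3
  -- path of even length 2(k+1) at a degree-2 triangle vertex v
  evenPath : ∀ {G} → InT G → (v : Fin (n G)) → deg G v ≡ 2 → InTriangle G v →
             (k : ℕ) → InT (attachPath G v (suc (2 * k)))
  -- path of odd length 2k+1 at v, its other end identified with a vertex of a new triangle
  oddPathTri : ∀ {G} → InT G → (v : Fin (n G)) → deg G v ≡ 2 → InTriangle G v →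
             (k : ℕ) →
             InT (attachTriangle (attachPath G v (2 * k)) (pathEnd G (2 * k)))

-- ²G and its colourings: each edge e of G gives two parallel edges, coloured
-- by the two components of col e (colours from Fin c).
Coloring2 : Graph → ℕ → Set
Coloring2 G c = Fin (length (edges G)) → Fin c × Fin c

mult : ∀ {c} → Fin c → Fin c × Fin c → ℕ
mult i (x , y) = (if does (x ≟ i) then 1 else 0) + (if does (y ≟ i) then 1 else 0)

degCol : (G : Graph) → ∀ {c} → Coloring2 G c → Fin c → Fin (n G) → ℕ
degCol G col i v =
  sum (map (λ e → if does (proj₁ (lookup (edges G) e) ≟ v) ∨ does (proj₂ (lookup (edges G) e) ≟ v)
                  then mult i (col e) else 0)
           (allFin (length (edges G))))

LocallyIrregular : (G : Graph) → ∀ {c} → Coloring2 G c → Set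
LocallyIrregular G col =
  ∀ i e → 1 ≤ mult i (col e) →
    degCol G col i (proj₁ (lookup (edges G) e)) ≢ degCol G col i (proj₂ (lookup (edges G) e))

lir²≤ : Graph → ℕ → Set
lir²≤ G c = Σ (Coloring2 G c) (LocallyIrregular G)

-- Induction over 𝔗 with a stronger invariant: ²G has a locally irregular
-- 3-edge-colouring in which every vertex of degree 2 misses some colour.
-- A new path is attached at a vertex v of degree 2 missing colour X, and both
-- copies of its first edge are coloured X. This raises only the X-degree of v,
-- from 0 to 2, and no old edge of colour X touches v, so the old edges stay
-- irregular. The path continues with the periodic pattern XX, XY, YY, XX, …
-- (Y = next X); its last edge, or the pendant triangle, is coloured according to
-- the phase of the pattern at the end, and the irregularity of every new edge is
-- a finite check. The third colour never occurs on a new edge, so every new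
-- vertex misses it.

module Submission where

open import Defs

open import Data.Bool using (true; false; if_then_else_; _∨_)
open import Data.Bool.Properties using (∨-identityʳ; ∨-zeroʳ)
open import Data.Empty using (⊥-elim)
open import Data.Fin using (Fin; zero; suc; _↑ˡ_; _↑ʳ_; fromℕ; _≟_; splitAt)
open import Data.Fin.Properties using (suc-injective; ↑ˡ-injective; ↑ʳ-injective; splitAt-↑ˡ; splitAt-↑ʳ; all?)
open import Data.List using (List; []; _∷_; _++_; map; length; lookup; tabulate)
open import Data.List.Properties using (map-tabulate; map-++)
open import Data.List.Membership.Propositional using (_∈_)
open import Data.List.Membership.Propositional.Properties using (∈-map⁻; ∈-++⁻)
open import Data.List.Relation.Unary.Any using (here; there)
open import Data.Nat using (ℕ; zero; suc; _+_; _*_; _≤_; _≤?_)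
import Data.Nat as ℕ
open import Data.Nat.ListAction using (sum)
open import Data.Nat.Properties using (+-identityʳ; +-assoc; m≤m+n; m≤n+m; ≤-trans; 1+n≰n; m+1+n≢m)
open import Data.Product using (_×_; _,_; proj₁; proj₂; ∃-syntax)
open import Data.Sum using (inj₁; inj₂; _⊎_)
open import Data.Vec using (Vec; []; _∷_)
import Data.Vec.Relation.Unary.All as VecAll
open import Data.Unit using (⊤)
open import Function using (_∘_; id)
open import Function.Definitions using (Injective)
open import Relation.Nullary using (Dec; yes; no; does; ¬?)
open import Relation.Nullary.Decidable using (True; toWitness; map′; does-≡; dec-true; dec-false; _→-dec_)
open import Relation.Binary.PropositionalEquality

private variable
  k L N s : ℕ

does-≟-injective : {g : Fin k → Fin N} → Injective _≡_ _≡_ g → ∀ a b → does (g a ≟ g b) ≡ does (a ≟ b)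
does-≟-injective {g = g} g-inj a b = does-≡ (g a ≟ g b) (map′ (cong g) g-inj (a ≟ b))

↑ˡ-inj : Injective {A = Fin k} _≡_ _≡_ (_↑ˡ s)
↑ˡ-inj {s = s} {a} {b} = ↑ˡ-injective s a b

↑ʳ-inj : Injective {A = Fin s} _≡_ _≡_ (k ↑ʳ_)
↑ʳ-inj {k = k} {a} {b} = ↑ʳ-injective k a b

↑ˡ≢↑ʳ : (u : Fin k) (p : Fin s) → u ↑ˡ s ≢ k ↑ʳ p
↑ˡ≢↑ʳ {k} {s} u p eq with trans (sym (splitAt-↑ˡ k u s)) (trans (cong (splitAt k) eq) (splitAt-↑ʳ k s p))
... | ()

data OldOrNew (k s : ℕ) : Fin (k + s) → Set where
  old : (u : Fin k) → OldOrNew k s (u ↑ˡ s)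
  new : (p : Fin s) → OldOrNew k s (k ↑ʳ p)

oldOrNew : ∀ k {s} (x : Fin (k + s)) → OldOrNew k s x
oldOrNew zero    x       = new x
oldOrNew (suc k) zero    = old zero
oldOrNew (suc k) (suc x) with oldOrNew k x
... | old u = old (suc u)
... | new p = new p

onlyAt : Fin N → ℕ → Fin N → ℕ
onlyAt v w u = if does (v ≟ u) then w else 0

onlyAt-self : (v : Fin N) (w : ℕ) → onlyAt v w v ≡ w
onlyAt-self v w rewrite dec-true (v ≟ v) refl = refl

onlyAt-other : {v u : Fin N} → u ≢ v → ∀ w → onlyAt v w u ≡ 0
onlyAt-other {v = v} {u} u≢v w rewrite dec-false (v ≟ u) (u≢v ∘ sym) = refl

onlyAt-zero : (v u : Fin N) → onlyAt v 0 u ≡ 0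
onlyAt-zero v u with does (v ≟ u)
... | true  = refl
... | false = refl

onlyAt-injective : {g : Fin k → Fin N} → Injective _≡_ _≡_ g → ∀ v w u → onlyAt (g v) w (g u) ≡ onlyAt v w u
onlyAt-injective g-inj v w u = cong (if_then w else 0) (does-≟-injective g-inj v u)

if-+ : ∀ b x z → (if b then x else 0) + ((if b then z else 0) + 0) ≡ (if b then x + z else 0)
if-+ true  x z = cong (x +_) (+-identityʳ z)
if-+ false x z = refl

ColourPair : Set
ColourPair = Fin 3 × Fin 3

ColouredEdge : ℕ → Set
ColouredEdge N = (Fin N × Fin N) × ColourPair

weightAt : (ColourPair → ℕ) → Fin N → ColouredEdge N → ℕ
weightAt f x ((a , b) , c) = if does (a ≟ x) ∨ does (b ≟ x) then f c else 0

degreeBy : (ColourPair → ℕ) → List (ColouredEdge N) → Fin N → ℕ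
degreeBy f []       x = 0
degreeBy f (e ∷ es) x = weightAt f x e + degreeBy f es x

degree : List (ColouredEdge N) → Fin N → ℕ
degree = degreeBy (λ _ → 1)

colourDegree : Fin 3 → List (ColouredEdge N) → Fin N → ℕ
colourDegree i = degreeBy (mult i)

degreeBy-++ : ∀ f (es es′ : List (ColouredEdge N)) x →
  degreeBy f (es ++ es′) x ≡ degreeBy f es x + degreeBy f es′ x
degreeBy-++ f []       es′ x = refl
degreeBy-++ f (e ∷ es) es′ x =
  trans (cong (weightAt f x e +_) (degreeBy-++ f es es′ x)) (sym (+-assoc (weightAt f x e) _ _))

weight≤degreeBy-src : ∀ f {es : List (ColouredEdge N)} {a b c} → ((a , b) , c) ∈ es → f c ≤ degreeBy f es a
weight≤degreeBy-src f {a = a} (here refl) rewrite dec-true (a ≟ a) refl = m≤m+n _ _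
weight≤degreeBy-src f (there e∈) = ≤-trans (weight≤degreeBy-src f e∈) (m≤n+m _ _)

weight≤degreeBy-tgt : ∀ f {es : List (ColouredEdge N)} {a b c} → ((a , b) , c) ∈ es → f c ≤ degreeBy f es b
weight≤degreeBy-tgt f {a = a} {b} (here refl)
  rewrite dec-true (b ≟ b) refl | ∨-zeroʳ (does (a ≟ b)) = m≤m+n _ _
weight≤degreeBy-tgt f (there e∈) = ≤-trans (weight≤degreeBy-tgt f e∈) (m≤n+m _ _)

relabel : (Fin k → Fin N) → ColouredEdge k → ColouredEdge N
relabel g ((a , b) , c) = ((g a , g b) , c)

degreeBy-relabel : ∀ f {g : Fin k → Fin N} → Injective _≡_ _≡_ g → (es : List (ColouredEdge k)) (y : Fin k) →
  degreeBy f (map (relabel g) es) (g y) ≡ degreeBy f es y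
degreeBy-relabel f g-inj [] y = refl
degreeBy-relabel f g-inj (((a , b) , c) ∷ es) y
  rewrite does-≟-injective g-inj a y | does-≟-injective g-inj b y =
  cong (weightAt f y ((a , b) , c) +_) (degreeBy-relabel f g-inj es y)

degreeBy-relabel-outside : ∀ f {g : Fin k → Fin N} {z} → (∀ t → g t ≢ z) → (es : List (ColouredEdge k)) →
  degreeBy f (map (relabel g) es) z ≡ 0
degreeBy-relabel-outside f z∉g [] = refl
degreeBy-relabel-outside f {g} {z} z∉g (((a , b) , c) ∷ es)
  rewrite dec-false (g a ≟ z) (z∉g a) | dec-false (g b ≟ z) (z∉g b) =
  degreeBy-relabel-outside f z∉g es

extend : List (ColouredEdge k) → List (ColouredEdge (k + s)) → List (ColouredEdge (k + s))
extend {s = s} es added = map (relabel (_↑ˡ s)) es ++ added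

degreeBy-extend-old : ∀ f (es : List (ColouredEdge k)) (added : List (ColouredEdge (k + s))) u →
  degreeBy f (extend es added) (u ↑ˡ s) ≡ degreeBy f es u + degreeBy f added (u ↑ˡ s)
degreeBy-extend-old {s = s} f es added u =
  trans (degreeBy-++ f (map (relabel (_↑ˡ s)) es) added (u ↑ˡ s))
        (cong (_+ degreeBy f added (u ↑ˡ s)) (degreeBy-relabel f ↑ˡ-inj es u))

degreeBy-extend-new : ∀ f (es : List (ColouredEdge k)) (added : List (ColouredEdge (k + s))) p →
  degreeBy f (extend es added) (k ↑ʳ p) ≡ degreeBy f added (k ↑ʳ p)
degreeBy-extend-new {s = s} f es added p =
  trans (degreeBy-++ f (map (relabel (_↑ˡ s)) es) added (_ ↑ʳ p))
        (cong (_+ degreeBy f added (_ ↑ʳ p)) (degreeBy-relabel-outside f (λ u → ↑ˡ≢↑ʳ u p) es))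

map-proj₁-relabel : {g : Fin k → Fin N} (h : Fin k × Fin k → Fin N × Fin N) → (∀ a b → h (a , b) ≡ (g a , g b)) →
  (es : List (ColouredEdge k)) → map proj₁ (map (relabel g) es) ≡ map h (map proj₁ es)
map-proj₁-relabel h h-def [] = refl
map-proj₁-relabel h h-def (((a , b) , c) ∷ es) = cong₂ _∷_ (sym (h-def a b)) (map-proj₁-relabel h h-def es)

Irregular : List (ColouredEdge N) → Set
Irregular es = ∀ i {a b c} → ((a , b) , c) ∈ es → 1 ≤ mult i c →
  colourDegree i es a ≢ colourDegree i es b

DegreeTwoMissesColour : List (ColouredEdge N) → Set
DegreeTwoMissesColour es = ∀ x → degree es x ≡ 2 → ∃[ j ] colourDegree j es x ≡ 0

-- The invariant of the induction: a colour missing at a vertex of degree 2 is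
-- what allows a path to be attached there.
GoodColouring : (N : ℕ) → List (Fin N × Fin N) → Set
GoodColouring N E = ∃[ es ] E ≡ map proj₁ es × Irregular es × DegreeTwoMissesColour es

colourOf : (es : List (ColouredEdge N)) → Coloring2 (mkGraph N (map proj₁ es)) 3
colourOf (e ∷ es) zero    = proj₂ e
colourOf (e ∷ es) (suc j) = colourOf es j

sum-tabulate-weightAt : ∀ f (es : List (ColouredEdge N)) x →
  sum (tabulate (λ j → weightAt f x (lookup (map proj₁ es) j , colourOf es j))) ≡ degreeBy f es x
sum-tabulate-weightAt f []       x = refl
sum-tabulate-weightAt f (e ∷ es) x = cong (weightAt f x e +_) (sum-tabulate-weightAt f es x)

degCol-colourOf : (es : List (ColouredEdge N)) (i : Fin 3) (x : Fin N) →
  degCol (mkGraph N (map proj₁ es)) (colourOf es) i x ≡ colourDegree i es x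
degCol-colourOf es i x =
  trans (cong sum (map-tabulate id (λ j → weightAt (mult i) x (lookup (map proj₁ es) j , colourOf es j))))
        (sum-tabulate-weightAt (mult i) es x)

lookup-colourOf-∈ : (es : List (ColouredEdge N)) (j : Fin (length (map proj₁ es))) →
  (lookup (map proj₁ es) j , colourOf es j) ∈ es
lookup-colourOf-∈ (e ∷ es) zero    = here refl
lookup-colourOf-∈ (e ∷ es) (suc j) = there (lookup-colourOf-∈ es j)

irregular⇒lir²≤3 : (es : List (ColouredEdge N)) → Irregular es → lir²≤ (mkGraph N (map proj₁ es)) 3
irregular⇒lir²≤3 es irr = colourOf es , λ i j i-used →
  subst₂ _≢_ (sym (degCol-colourOf es i _)) (sym (degCol-colourOf es i _))
         (irr i (lookup-colourOf-∈ es j) i-used)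

deg≡degree : (es : List (ColouredEdge N)) (x : Fin N) → deg (mkGraph N (map proj₁ es)) x ≡ degree es x
deg≡degree []       x = refl
deg≡degree (e ∷ es) x = cong (weightAt _ x e +_) (deg≡degree es x)

mult-XX-other : {i X : Fin 3} → i ≢ X → mult i (X , X) ≡ 0
mult-XX-other {i} {X} i≢X rewrite dec-false (X ≟ i) (i≢X ∘ sym) = refl

module DoubledEdgeAtMissingColour
  {k N : ℕ} (es : List (ColouredEdge k)) (es′ : List (ColouredEdge N)) (ι : Fin k → Fin N)
  (v : Fin k) (X : Fin 3) (X-missing : colourDegree X es v ≡ 0)
  (degreeBy-ι : ∀ f u → degreeBy f es′ (ι u) ≡ degreeBy f es u + onlyAt v (f (X , X)) u)
  where

  degreeBy-ι-other : ∀ f {u} → u ≢ v → degreeBy f es′ (ι u) ≡ degreeBy f es u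
  degreeBy-ι-other f {u} u≢v =
    trans (degreeBy-ι f u) (trans (cong (degreeBy f es u +_) (onlyAt-other u≢v _)) (+-identityʳ _))

  colourDegree-ι : ∀ i u → i ≢ X ⊎ u ≢ v → colourDegree i es′ (ι u) ≡ colourDegree i es u
  colourDegree-ι i u (inj₂ u≢v) = degreeBy-ι-other (mult i) u≢v
  colourDegree-ι i u (inj₁ i≢X) =
    trans (degreeBy-ι (mult i) u) (trans (cong (λ w → colourDegree i es u + onlyAt v w u) (mult-XX-other i≢X))
                                         (trans (cong (colourDegree i es u +_) (onlyAt-zero v u)) (+-identityʳ _)))

  irregular-ι : Irregular es → ∀ i {a b c} → ((a , b) , c) ∈ es → 1 ≤ mult i c →
    colourDegree i es′ (ι a) ≢ colourDegree i es′ (ι b)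
  irregular-ι irr i {a} {b} {c} e∈ i-used =
    irr i e∈ i-used ∘ subst₂ _≡_ (colourDegree-ι i a (avoids (weight≤degreeBy-src (mult i) e∈)))
                                  (colourDegree-ι i b (avoids (weight≤degreeBy-tgt (mult i) e∈)))
    where
    -- An old edge of colour X cannot end at v, which misses X.
    avoids : ∀ {x} → mult i c ≤ colourDegree i es x → i ≢ X ⊎ x ≢ v
    avoids c≤ with i ≟ X
    ... | no i≢X   = inj₁ i≢X
    ... | yes refl = inj₂ λ { refl → 1+n≰n (≤-trans i-used (subst (mult X c ≤_) X-missing c≤)) }

  misses-ι : degree es v ≡ 2 → DegreeTwoMissesColour es →
    ∀ u → degree es′ (ι u) ≡ 2 → ∃[ j ] colourDegree j es′ (ι u) ≡ 0
  misses-ι deg-v miss u deg-u with u ≟ v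
  ... | yes refl =
    ⊥-elim (m+1+n≢m 2 (trans (sym (cong₂ _+_ deg-v (onlyAt-self v 1))) (trans (sym (degreeBy-ι _ v)) deg-u)))
  ... | no u≢v with miss u (trans (sym (degreeBy-ι-other _ u≢v)) deg-u)
  ...   | j , j-missing = j , trans (colourDegree-ι j u (inj₂ u≢v)) j-missing

pathEdges : Vec ColourPair L → List (ColouredEdge (suc L))
pathEdges []       = []
pathEdges (c ∷ cs) = ((zero , suc zero) , c) ∷ map (relabel suc) (pathEdges cs)

pathEdges-endpoints : (cs : Vec ColourPair L) → map proj₁ (pathEdges cs) ≡ pathList (suc L)
pathEdges-endpoints []       = refl
pathEdges-endpoints (c ∷ cs) =
  cong ((zero , suc zero) ∷_)
       (trans (map-proj₁-relabel _ (λ _ _ → refl) (pathEdges cs)) (cong (map _) (pathEdges-endpoints cs)))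

-- Vertex p of the path coloured cs, when vertex 0 also carries an edge coloured c₀
-- and the last vertex carries the extra weight e.
pathDegree : (ColourPair → ℕ) → ColourPair → Vec ColourPair L → ℕ → Fin (suc L) → ℕ
pathDegree f c₀ []       e zero    = f c₀ + e
pathDegree f c₀ (c ∷ cs) e zero    = f c₀ + f c
pathDegree f c₀ (c ∷ cs) e (suc p) = pathDegree f c cs e p

pathDegree-edges : ∀ f c₀ (cs : Vec ColourPair L) p →
  pathDegree f c₀ cs 0 p ≡ onlyAt zero (f c₀) p + degreeBy f (pathEdges cs) p
pathDegree-edges f c₀ []       zero    = refl
pathDegree-edges f c₀ (c ∷ cs) zero    =
  cong (f c₀ +_) (sym (trans (cong (f c +_) (degreeBy-relabel-outside f (λ _ ()) (pathEdges cs))) (+-identityʳ (f c))))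
pathDegree-edges f c₀ (c ∷ cs) (suc p) =
  trans (pathDegree-edges f c cs p)
        (cong (onlyAt zero (f c) p +_) (sym (degreeBy-relabel f suc-injective (pathEdges cs) p)))

pathDegree-extra : ∀ f c₀ (cs : Vec ColourPair L) e p →
  pathDegree f c₀ cs e p ≡ pathDegree f c₀ cs 0 p + onlyAt (fromℕ L) e p
pathDegree-extra f c₀ []       e zero    = cong (_+ e) (sym (+-identityʳ (f c₀)))
pathDegree-extra f c₀ (c ∷ cs) e zero    = sym (+-identityʳ _)
pathDegree-extra f c₀ (c ∷ cs) e (suc p) = pathDegree-extra f c cs e p

IrregularPath : ColourPair → Vec ColourPair L → (Fin 3 → ℕ) → Set
IrregularPath c₀ []       e = ⊤
IrregularPath c₀ (c ∷ cs) e =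
  (∀ i → 1 ≤ mult i c → pathDegree (mult i) c₀ (c ∷ cs) (e i) zero ≢ pathDegree (mult i) c cs (e i) zero)
  × IrregularPath c cs e

pathEdges-irregular : ∀ c₀ (cs : Vec ColourPair L) e → IrregularPath c₀ cs e →
  ∀ i {a b c} → ((a , b) , c) ∈ pathEdges cs → 1 ≤ mult i c →
  pathDegree (mult i) c₀ cs (e i) a ≢ pathDegree (mult i) c₀ cs (e i) b
pathEdges-irregular c₀ (c ∷ cs) e (first , rest) i (here refl) = first i
pathEdges-irregular c₀ (c ∷ cs) e (first , rest) i (there e∈) with ∈-map⁻ (relabel suc) e∈
... | ((a , b) , c′) , e′∈ , refl = pathEdges-irregular c cs e rest i e′∈

pathDegree-vanishing : ∀ f {c₀} {cs : Vec ColourPair L} {e} → f c₀ ≡ 0 → VecAll.All (λ c → f c ≡ 0) cs → e ≡ 0 →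
  ∀ p → pathDegree f c₀ cs e p ≡ 0
pathDegree-vanishing f fc₀≡0 VecAll.[]             e≡0 zero    = cong₂ _+_ fc₀≡0 e≡0
pathDegree-vanishing f fc₀≡0 (fc≡0 VecAll.∷ rest) e≡0 zero    = cong₂ _+_ fc₀≡0 fc≡0
pathDegree-vanishing f fc₀≡0 (fc≡0 VecAll.∷ rest) e≡0 (suc p) = pathDegree-vanishing f fc≡0 rest e≡0 p

module PathAttachment {k L : ℕ} (es : List (ColouredEdge k)) (v : Fin k) (X : Fin 3) (cs : Vec ColourPair L) where

  pathPart : List (ColouredEdge (k + suc L))
  pathPart = ((v ↑ˡ suc L , k ↑ʳ zero) , (X , X)) ∷ map (relabel (k ↑ʳ_)) (pathEdges cs)

  attached : List (ColouredEdge (k + suc L))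
  attached = extend es pathPart

  attached-endpoints : edges (attachPath (mkGraph k (map proj₁ es)) v L) ≡ map proj₁ attached
  attached-endpoints = sym (trans (map-++ proj₁ (map (relabel (_↑ˡ suc L)) es) pathPart)
    (cong₂ _++_ (map-proj₁-relabel _ (λ _ _ → refl) es)
                (cong (_ ∷_) (trans (map-proj₁-relabel _ (λ _ _ → refl) (pathEdges cs))
                                    (cong (map _) (pathEdges-endpoints cs))))))

  degreeBy-old : ∀ f u → degreeBy f attached (u ↑ˡ suc L) ≡ degreeBy f es u + onlyAt v (f (X , X)) u
  degreeBy-old f u = trans (degreeBy-extend-old f es pathPart u) (cong (degreeBy f es u +_) pathPart-old)
    where
    pathPart-old : degreeBy f pathPart (u ↑ˡ suc L) ≡ onlyAt v (f (X , X)) u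
    pathPart-old
      rewrite does-≟-injective (↑ˡ-inj {s = suc L}) v u
            | dec-false (k ↑ʳ zero ≟ u ↑ˡ suc L) (↑ˡ≢↑ʳ u zero ∘ sym)
            | ∨-identityʳ (does (v ≟ u))
            | degreeBy-relabel-outside f (λ p → ↑ˡ≢↑ʳ u p ∘ sym) (pathEdges cs) = +-identityʳ _

  degreeBy-new : ∀ f p → degreeBy f attached (k ↑ʳ p) ≡ pathDegree f (X , X) cs 0 p
  degreeBy-new f p =
    trans (degreeBy-extend-new f es pathPart p) (trans pathPart-new (sym (pathDegree-edges f (X , X) cs p)))
    where
    pathPart-new : degreeBy f pathPart (k ↑ʳ p) ≡ onlyAt zero (f (X , X)) p + degreeBy f (pathEdges cs) p
    pathPart-new
      rewrite dec-false (v ↑ˡ suc L ≟ k ↑ʳ p) (↑ˡ≢↑ʳ v p)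
            | does-≟-injective (↑ʳ-inj {k = k}) zero p =
      cong (onlyAt zero (f (X , X)) p +_) (degreeBy-relabel f ↑ʳ-inj (pathEdges cs) p)

  -- Stated for any es′ with the right degrees at the images under κ of the old and
  -- path vertices, so that the odd case can add its triangle afterwards.
  attached-irregular :
    ∀ {N} (es′ : List (ColouredEdge N)) (κ : Fin (k + suc L) → Fin N) (e : Fin 3 → ℕ) →
    (∀ f u → degreeBy f es′ (κ (u ↑ˡ suc L)) ≡ degreeBy f es u + onlyAt v (f (X , X)) u) →
    (∀ i p → colourDegree i es′ (κ (k ↑ʳ p)) ≡ pathDegree (mult i) (X , X) cs (e i) p) →
    Irregular es → colourDegree X es v ≡ 0 →
    mult X (X , X) ≢ pathDegree (mult X) (X , X) cs (e X) zero → IrregularPath (X , X) cs e →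
    ∀ i {a b c} → ((a , b) , c) ∈ attached → 1 ≤ mult i c → colourDegree i es′ (κ a) ≢ colourDegree i es′ (κ b)
  attached-irregular es′ κ e degreeBy-κ-old colourDegree-κ-new irr X-missing first-irr path-irr i e∈
    with ∈-++⁻ (map (relabel (_↑ˡ suc L)) es) e∈
  ... | inj₁ old∈ with ∈-map⁻ (relabel (_↑ˡ suc L)) old∈
  ...   | ((a , b) , c) , e′∈ , refl =
    DoubledEdgeAtMissingColour.irregular-ι es es′ (κ ∘ (_↑ˡ suc L)) v X X-missing degreeBy-κ-old irr i e′∈
  attached-irregular es′ κ e degreeBy-κ-old colourDegree-κ-new irr X-missing first-irr path-irr i e∈
      | inj₂ (here refl) with i ≟ X
  ... | no i≢X    = λ i-used → ⊥-elim (1+n≰n (subst (1 ≤_) (mult-XX-other i≢X) i-used))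
  ... | yes refl  = λ _ eq → first-irr (trans (sym v-degree) (trans eq (colourDegree-κ-new X zero)))
    where
    v-degree : colourDegree X es′ (κ (v ↑ˡ suc L)) ≡ mult X (X , X)
    v-degree = trans (degreeBy-κ-old (mult X) v) (cong₂ _+_ X-missing (onlyAt-self v _))
  attached-irregular es′ κ e degreeBy-κ-old colourDegree-κ-new irr X-missing first-irr path-irr i e∈
      | inj₂ (there path∈) with ∈-map⁻ (relabel (k ↑ʳ_)) path∈
  ... | ((a , b) , c) , e′∈ , refl = λ i-used eq →
    pathEdges-irregular (X , X) cs e path-irr i e′∈ i-used
      (trans (sym (colourDegree-κ-new i a)) (trans eq (colourDegree-κ-new i b)))

module TriangleAttachment {k : ℕ} (es : List (ColouredEdge k)) (w : Fin k) (c₁ c₂ c₃ : ColourPair) where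

  a b : Fin (k + 2)
  a = k ↑ʳ zero
  b = k ↑ʳ suc zero

  a≢b : a ≢ b
  a≢b eq with ↑ʳ-injective k zero (suc zero) eq
  ... | ()

  trianglePart : List (ColouredEdge (k + 2))
  trianglePart = ((w ↑ˡ 2 , a) , c₁) ∷ ((w ↑ˡ 2 , b) , c₂) ∷ ((a , b) , c₃) ∷ []

  attached : List (ColouredEdge (k + 2))
  attached = extend es trianglePart

  attached-endpoints : (E : List (Fin k × Fin k)) → E ≡ map proj₁ es →
    edges (attachTriangle (mkGraph k E) w) ≡ map proj₁ attached
  attached-endpoints E refl = sym (trans (map-++ proj₁ (map (relabel (_↑ˡ 2)) es) trianglePart)
    (cong (_++ _) (map-proj₁-relabel _ (λ _ _ → refl) es)))

  degreeBy-old : ∀ f y → degreeBy f attached (y ↑ˡ 2) ≡ degreeBy f es y + onlyAt w (f c₁ + f c₂) y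
  degreeBy-old f y = trans (degreeBy-extend-old f es trianglePart y) (cong (degreeBy f es y +_) trianglePart-old)
    where
    trianglePart-old : degreeBy f trianglePart (y ↑ˡ 2) ≡ onlyAt w (f c₁ + f c₂) y
    trianglePart-old
      rewrite does-≟-injective (↑ˡ-inj {s = 2}) w y
            | dec-false (a ≟ y ↑ˡ 2) (↑ˡ≢↑ʳ y zero ∘ sym)
            | dec-false (b ≟ y ↑ˡ 2) (↑ˡ≢↑ʳ y (suc zero) ∘ sym)
            | ∨-identityʳ (does (w ≟ y)) = if-+ (does (w ≟ y)) (f c₁) (f c₂)

  degreeBy-a : ∀ f → degreeBy f attached a ≡ f c₁ + f c₃
  degreeBy-a f
    rewrite degreeBy-extend-new f es trianglePart zero
          | dec-false (w ↑ˡ 2 ≟ a) (↑ˡ≢↑ʳ w zero)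
          | dec-true (a ≟ a) refl
          | dec-false (b ≟ a) (a≢b ∘ sym) = cong (f c₁ +_) (+-identityʳ _)

  degreeBy-b : ∀ f → degreeBy f attached b ≡ f c₂ + f c₃
  degreeBy-b f
    rewrite degreeBy-extend-new f es trianglePart (suc zero)
          | dec-false (w ↑ˡ 2 ≟ b) (↑ˡ≢↑ʳ w (suc zero))
          | dec-false (a ≟ b) a≢b
          | dec-true (b ≟ b) refl = cong (f c₂ +_) (+-identityʳ _)

byExhaustion : ∀ {n} {P : Fin n → Set} (P? : ∀ x → Dec (P x)) → {True (all? P?)} → ∀ x → P x
byExhaustion P? {all-true} = toWitness all-true

irregular? : ∀ m x y → Dec (1 ≤ m → x ≢ y)
irregular? m x y = (1 ≤? m) →-dec ¬? (x ℕ.≟ y)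

next : Fin 3 → Fin 3
next zero             = suc zero
next (suc zero)       = suc (suc zero)
next (suc (suc zero)) = zero

third : Fin 3 → Fin 3
third = next ∘ next

phaseColour : Fin 3 → Fin 3 → ColourPair
phaseColour X zero             = (X , X)
phaseColour X (suc zero)       = (X , next X)
phaseColour X (suc (suc zero)) = (next X , next X)

phaseColours : Fin 3 → Fin 3 → (L : ℕ) → Vec ColourPair L
phaseColours X ph zero    = []
phaseColours X ph (suc L) = phaseColour X ph ∷ phaseColours X (next ph) L

phaseAfter : Fin 3 → ℕ → Fin 3
phaseAfter ph zero    = ph
phaseAfter ph (suc L) = phaseAfter (next ph) L

finalColour : Fin 3 → Fin 3 → ColourPair
finalColour X zero             = (next X , next X)
finalColour X (suc zero)       = (X , X)
finalColour X (suc (suc zero)) = (next X , next X)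

phaseColoursThenFinal : Fin 3 → Fin 3 → (L : ℕ) → Vec ColourPair (suc L)
phaseColoursThenFinal X ph zero    = finalColour X ph ∷ []
phaseColoursThenFinal X ph (suc L) = phaseColour X ph ∷ phaseColoursThenFinal X (next ph) L

-- The triangle w a b hung at the end w of a path whose last edge has phase q:
-- wa is coloured (X , X), wb and ab as below.
wbColour : Fin 3 → Fin 3 → ColourPair
wbColour X zero             = (X , next X)
wbColour X (suc zero)       = (X , next X)
wbColour X (suc (suc zero)) = (next X , next X)

abColour : Fin 3 → Fin 3 → ColourPair
abColour X zero             = (X , next X)
abColour X (suc zero)       = (next X , next X)
abColour X (suc (suc zero)) = (X , X)

triangleWeight : Fin 3 → Fin 3 → Fin 3 → ℕ
triangleWeight X q i = mult i (X , X) + mult i (wbColour X q)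

phaseColour-step : ∀ X ph i → 1 ≤ mult i (phaseColour X (next ph)) →
  mult i (phaseColour X ph) + mult i (phaseColour X (next ph))
    ≢ mult i (phaseColour X (next ph)) + mult i (phaseColour X (next (next ph)))
phaseColour-step = byExhaustion λ X → all? λ ph → all? λ i → irregular? (mult i (phaseColour X (next ph)))
  (mult i (phaseColour X ph) + mult i (phaseColour X (next ph)))
  (mult i (phaseColour X (next ph)) + mult i (phaseColour X (next (next ph))))

phaseColour-before-triangle : ∀ X ph i → 1 ≤ mult i (phaseColour X (next ph)) →
  mult i (phaseColour X ph) + mult i (phaseColour X (next ph))
    ≢ mult i (phaseColour X (next ph)) + triangleWeight X (next ph) i
phaseColour-before-triangle = byExhaustion λ X → all? λ ph → all? λ i → irregular? (mult i (phaseColour X (next ph)))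
  (mult i (phaseColour X ph) + mult i (phaseColour X (next ph)))
  (mult i (phaseColour X (next ph)) + triangleWeight X (next ph) i)

phaseColour-before-final : ∀ X ph i → 1 ≤ mult i (phaseColour X (next ph)) →
  mult i (phaseColour X ph) + mult i (phaseColour X (next ph))
    ≢ mult i (phaseColour X (next ph)) + mult i (finalColour X (next (next ph)))
phaseColour-before-final = byExhaustion λ X → all? λ ph → all? λ i → irregular? (mult i (phaseColour X (next ph)))
  (mult i (phaseColour X ph) + mult i (phaseColour X (next ph)))
  (mult i (phaseColour X (next ph)) + mult i (finalColour X (next (next ph))))

finalColour-after-phaseColour : ∀ X ph i → 1 ≤ mult i (finalColour X (next ph)) →
  mult i (phaseColour X ph) + mult i (finalColour X (next ph)) ≢ mult i (finalColour X (next ph)) + 0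
finalColour-after-phaseColour = byExhaustion λ X → all? λ ph → all? λ i → irregular? (mult i (finalColour X (next ph)))
  (mult i (phaseColour X ph) + mult i (finalColour X (next ph)))
  (mult i (finalColour X (next ph)) + 0)

phaseColours-irregular : ∀ X ph L →
  IrregularPath (phaseColour X ph) (phaseColours X (next ph) L) (triangleWeight X (phaseAfter ph L))
phaseColours-irregular X ph zero          = _
phaseColours-irregular X ph (suc zero)    = phaseColour-before-triangle X ph , _
phaseColours-irregular X ph (suc (suc L)) = phaseColour-step X ph , phaseColours-irregular X (next ph) (suc L)

phaseColoursThenFinal-irregular : ∀ X ph L → IrregularPath (phaseColour X ph) (phaseColoursThenFinal X (next ph) L) (λ _ → 0)
phaseColoursThenFinal-irregular X ph zero          = finalColour-after-phaseColour X ph , _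
phaseColoursThenFinal-irregular X ph (suc zero)    = phaseColour-before-final X ph , phaseColoursThenFinal-irregular X (next ph) zero
phaseColoursThenFinal-irregular X ph (suc (suc L)) = phaseColour-step X ph , phaseColoursThenFinal-irregular X (next ph) (suc L)

triangle-wa : ∀ X q i → 1 ≤ mult i (X , X) →
  mult i (phaseColour X q) + triangleWeight X q i ≢ mult i (X , X) + mult i (abColour X q)
triangle-wa = byExhaustion λ X → all? λ q → all? λ i → irregular? (mult i (X , X))
  (mult i (phaseColour X q) + triangleWeight X q i) (mult i (X , X) + mult i (abColour X q))

triangle-wb : ∀ X q i → 1 ≤ mult i (wbColour X q) →
  mult i (phaseColour X q) + triangleWeight X q i ≢ mult i (wbColour X q) + mult i (abColour X q)
triangle-wb = byExhaustion λ X → all? λ q → all? λ i → irregular? (mult i (wbColour X q))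
  (mult i (phaseColour X q) + triangleWeight X q i) (mult i (wbColour X q) + mult i (abColour X q))

triangle-ab : ∀ X q i → 1 ≤ mult i (abColour X q) →
  mult i (X , X) + mult i (abColour X q) ≢ mult i (wbColour X q) + mult i (abColour X q)
triangle-ab = byExhaustion λ X → all? λ q → all? λ i → irregular? (mult i (abColour X q))
  (mult i (X , X) + mult i (abColour X q)) (mult i (wbColour X q) + mult i (abColour X q))

firstEdge-irregular-even : ∀ X L → mult X (X , X) ≢ pathDegree (mult X) (X , X) (phaseColoursThenFinal X (suc zero) L) 0 zero
firstEdge-irregular-even X zero    = byExhaustion (λ X → ¬? (mult X (X , X) ℕ.≟ mult X (X , X) + mult X (X , X))) X
firstEdge-irregular-even X (suc L) = byExhaustion (λ X → ¬? (mult X (X , X) ℕ.≟ mult X (X , X) + mult X (X , next X))) X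

firstEdge-irregular-odd : ∀ X L →
  mult X (X , X) ≢ pathDegree (mult X) (X , X) (phaseColours X (suc zero) L) (triangleWeight X (phaseAfter zero L) X) zero
firstEdge-irregular-odd X zero    = byExhaustion (λ X → ¬? (mult X (X , X) ℕ.≟ mult X (X , X) + triangleWeight X zero X)) X
firstEdge-irregular-odd X (suc L) = byExhaustion (λ X → ¬? (mult X (X , X) ℕ.≟ mult X (X , X) + mult X (X , next X))) X

phaseColours-lastDegree : ∀ f X ph L e →
  pathDegree f (phaseColour X ph) (phaseColours X (next ph) L) e (fromℕ L) ≡ f (phaseColour X (phaseAfter ph L)) + e
phaseColours-lastDegree f X ph zero    e = refl
phaseColours-lastDegree f X ph (suc L) e = phaseColours-lastDegree f X (next ph) L e

third-unused-phaseColour : ∀ X ph → mult (third X) (phaseColour X ph) ≡ 0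
third-unused-phaseColour = byExhaustion λ X → all? λ ph → mult (third X) (phaseColour X ph) ℕ.≟ 0

third-unused-final : ∀ X ph → mult (third X) (finalColour X ph) ≡ 0
third-unused-final = byExhaustion λ X → all? λ ph → mult (third X) (finalColour X ph) ℕ.≟ 0

third-unused-wb : ∀ X q → mult (third X) (wbColour X q) ≡ 0
third-unused-wb = byExhaustion λ X → all? λ q → mult (third X) (wbColour X q) ℕ.≟ 0

third-unused-ab : ∀ X q → mult (third X) (abColour X q) ≡ 0
third-unused-ab = byExhaustion λ X → all? λ q → mult (third X) (abColour X q) ℕ.≟ 0

third-unused-phaseColours : ∀ X ph L → VecAll.All (λ c → mult (third X) c ≡ 0) (phaseColours X ph L)
third-unused-phaseColours X ph zero    = VecAll.[]
third-unused-phaseColours X ph (suc L) =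
  third-unused-phaseColour X ph VecAll.∷ third-unused-phaseColours X (next ph) L

third-unused-phaseColoursThenFinal : ∀ X ph L → VecAll.All (λ c → mult (third X) c ≡ 0) (phaseColoursThenFinal X ph L)
third-unused-phaseColoursThenFinal X ph zero    = third-unused-final X ph VecAll.∷ VecAll.[]
third-unused-phaseColoursThenFinal X ph (suc L) =
  third-unused-phaseColour X ph VecAll.∷ third-unused-phaseColoursThenFinal X (next ph) L

attachEvenPath-good : {E : List (Fin k × Fin k)} → GoodColouring k E → (v : Fin k) → deg (mkGraph k E) v ≡ 2 →
  ∀ L → GoodColouring (k + suc (suc L)) (edges (attachPath (mkGraph k E) v (suc L)))
attachEvenPath-good {k} (es , refl , irr , miss) v deg-v L with miss v (trans (sym (deg≡degree es v)) deg-v)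
... | X , X-missing = attached , attached-endpoints , irregular , misses
  where
  open PathAttachment es v X (phaseColoursThenFinal X (suc zero) L)

  irregular : Irregular attached
  irregular = attached-irregular attached id (λ _ → 0) degreeBy-old (λ i → degreeBy-new (mult i))
                irr X-missing (firstEdge-irregular-even X L) (phaseColoursThenFinal-irregular X zero L)

  misses : DegreeTwoMissesColour attached
  misses x deg-x with oldOrNew k x
  ... | old u = DoubledEdgeAtMissingColour.misses-ι es attached (_↑ˡ _) v X X-missing degreeBy-old
                  (trans (sym (deg≡degree es v)) deg-v) miss u deg-x
  ... | new p = third X , trans (degreeBy-new _ p)
                  (pathDegree-vanishing _ (third-unused-phaseColour X zero)
                     (third-unused-phaseColoursThenFinal X (suc zero) L) refl p)

module PathWithTriangle {k : ℕ} (es : List (ColouredEdge k)) (v : Fin k) (X : Fin 3) (L : ℕ) where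

  q : Fin 3
  q = phaseAfter zero L

  cs : Vec ColourPair L
  cs = phaseColours X (suc zero) L

  w : Fin (k + suc L)
  w = k ↑ʳ fromℕ L

  module P = PathAttachment es v X cs
  module T = TriangleAttachment P.attached w (X , X) (wbColour X q) (abColour X q)

  degreeBy-old : ∀ f u → degreeBy f T.attached ((u ↑ˡ suc L) ↑ˡ 2) ≡ degreeBy f es u + onlyAt v (f (X , X)) u
  degreeBy-old f u = begin
    degreeBy f T.attached ((u ↑ˡ suc L) ↑ˡ 2)
      ≡⟨ T.degreeBy-old f (u ↑ˡ suc L) ⟩
    degreeBy f P.attached (u ↑ˡ suc L) + onlyAt w _ (u ↑ˡ suc L)
      ≡⟨ cong (degreeBy f P.attached (u ↑ˡ suc L) +_) (onlyAt-other (↑ˡ≢↑ʳ u _) _) ⟩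
    degreeBy f P.attached (u ↑ˡ suc L) + 0
      ≡⟨ +-identityʳ _ ⟩
    degreeBy f P.attached (u ↑ˡ suc L)
      ≡⟨ P.degreeBy-old f u ⟩
    degreeBy f es u + onlyAt v (f (X , X)) u ∎
    where open ≡-Reasoning

  colourDegree-path : ∀ i p →
    colourDegree i T.attached ((k ↑ʳ p) ↑ˡ 2) ≡ pathDegree (mult i) (X , X) cs (triangleWeight X q i) p
  colourDegree-path i p = begin
    colourDegree i T.attached ((k ↑ʳ p) ↑ˡ 2)
      ≡⟨ T.degreeBy-old _ (k ↑ʳ p) ⟩
    colourDegree i P.attached (k ↑ʳ p) + onlyAt w (triangleWeight X q i) (k ↑ʳ p)
      ≡⟨ cong₂ _+_ (P.degreeBy-new _ p) (onlyAt-injective (↑ʳ-inj {k = k}) (fromℕ L) _ p) ⟩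
    pathDegree (mult i) (X , X) cs 0 p + onlyAt (fromℕ L) (triangleWeight X q i) p
      ≡⟨ pathDegree-extra _ _ cs _ p ⟨
    pathDegree (mult i) (X , X) cs (triangleWeight X q i) p ∎
    where open ≡-Reasoning

  colourDegree-w : ∀ i → colourDegree i T.attached (w ↑ˡ 2) ≡ mult i (phaseColour X q) + triangleWeight X q i
  colourDegree-w i = trans (colourDegree-path i (fromℕ L)) (phaseColours-lastDegree (mult i) X zero L _)

attachOddPathTriangle-good : {E : List (Fin k × Fin k)} → GoodColouring k E → (v : Fin k) → deg (mkGraph k E) v ≡ 2 →
  ∀ L → GoodColouring (k + suc L + 2) (edges (attachTriangle (attachPath (mkGraph k E) v L) (pathEnd (mkGraph k E) L)))
attachOddPathTriangle-good {k} (es , refl , irr , miss) v deg-v L with miss v (trans (sym (deg≡degree es v)) deg-v)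
... | X , X-missing = T.attached , T.attached-endpoints _ P.attached-endpoints , irregular , misses
  where
  open PathWithTriangle es v X L

  irregular : Irregular T.attached
  irregular i e∈ with ∈-++⁻ (map (relabel (_↑ˡ 2)) P.attached) e∈
  ... | inj₁ path∈ with ∈-map⁻ (relabel (_↑ˡ 2)) path∈
  ...   | ((a , b) , c) , e′∈ , refl =
    P.attached-irregular T.attached (_↑ˡ 2) (triangleWeight X q) degreeBy-old colourDegree-path
      irr X-missing (firstEdge-irregular-odd X L) (phaseColours-irregular X zero L) i e′∈
  irregular i e∈ | inj₂ (here refl) = λ i-used eq →
    triangle-wa X q i i-used (trans (sym (colourDegree-w i)) (trans eq (T.degreeBy-a _)))
  irregular i e∈ | inj₂ (there (here refl)) = λ i-used eq →
    triangle-wb X q i i-used (trans (sym (colourDegree-w i)) (trans eq (T.degreeBy-b _)))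
  irregular i e∈ | inj₂ (there (there (here refl))) = λ i-used eq →
    triangle-ab X q i i-used (trans (sym (T.degreeBy-a _)) (trans eq (T.degreeBy-b _)))

  misses : DegreeTwoMissesColour T.attached
  misses x deg-x with oldOrNew (k + suc L) x
  misses x deg-x | old y with oldOrNew k y
  ... | old u = DoubledEdgeAtMissingColour.misses-ι es T.attached (λ u → (u ↑ˡ suc L) ↑ˡ 2) v X X-missing
                  degreeBy-old (trans (sym (deg≡degree es v)) deg-v) miss u deg-x
  ... | new p = third X , trans (colourDegree-path (third X) p)
                  (pathDegree-vanishing _ (third-unused-phaseColour X zero) (third-unused-phaseColours X (suc zero) L)
                     (cong₂ _+_ (third-unused-phaseColour X zero) (third-unused-wb X q)) p)
  misses x deg-x | new zero = third X , trans (T.degreeBy-a _)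
                  (cong₂ _+_ (third-unused-phaseColour X zero) (third-unused-ab X q))
  misses x deg-x | new (suc zero) = third X , trans (T.degreeBy-b _)
                  (cong₂ _+_ (third-unused-wb X q) (third-unused-ab X q))

triangleColouring : List (ColouredEdge 3)
triangleColouring = ((zero , suc zero) , (zero , zero)) ∷ ((suc zero , suc (suc zero)) , (zero , suc zero))
                  ∷ ((zero , suc (suc zero)) , (suc zero , suc zero)) ∷ []

triangle-good : GoodColouring 3 (edges K3)
triangle-good = triangleColouring , refl , irregular , λ x _ → suc (suc zero) , third-unused x
  where
  irregular : Irregular triangleColouring
  irregular i (here refl) = byExhaustion (λ i → irregular? (mult i (zero , zero))
    (colourDegree i triangleColouring zero) (colourDegree i triangleColouring (suc zero))) i
  irregular i (there (here refl)) = byExhaustion (λ i → irregular? (mult i (zero , suc zero))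
    (colourDegree i triangleColouring (suc zero)) (colourDegree i triangleColouring (suc (suc zero)))) i
  irregular i (there (there (here refl))) = byExhaustion (λ i → irregular? (mult i (suc zero , suc zero))
    (colourDegree i triangleColouring zero) (colourDegree i triangleColouring (suc (suc zero)))) i

  third-unused : ∀ x → colourDegree (suc (suc zero)) triangleColouring x ≡ 0
  third-unused = byExhaustion (λ x → colourDegree (suc (suc zero)) triangleColouring x ℕ.≟ 0)

good : ∀ {G} → InT G → GoodColouring (n G) (edges G)
good tri                          = triangle-good
good (evenPath t v deg-v _ k)     = attachEvenPath-good (good t) v deg-v (2 * k)
good (oddPathTri t v deg-v _ k)   = attachOddPathTriangle-good (good t) v deg-v (2 * k)

lemma2 : (G : Graph) → InT G → lir²≤ G 3
lemma2 (mkGraph N E) t with good t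
... | es , refl , irr , _ = irregular⇒lir²≤3 es irr
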